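{- For all integers $n\ge 2$ and $0<d<n$, we have $M^{[1]}(d,n)=n-1$.
   Context: Group testing setting: a population of $n$ items contains exactly $d$ defective items, where $d$ is known in advance. A test is applied to a subset of the population and its outcome is positive if the subset contains at least one defective item and negative otherwise. Tests are performed sequentially (adaptively): the result of each test is known before the next test is chosen. An algorithm solves the $(d,n)$-problem if it always identifies the set of defective items. $M^{[k]}(d,n)$ denotes the minimum, over all such sequential algorithms in which every tested subset has size exactly $k$, of the worst-case number of tests used; if no such algorithm exists, $M^{[k]}(d,n)=\infty$. -}

module Defs where

open import Data.Nat using (ℕ; zero; suc; _≤_; _+_)
open import Data.Bool using (Bool; true; false; if_then_else_)
open import Data.Fin.Subset using (Subset; ∣_∣; _∩_; Nonempty)
open import Data.Fin.Subset.Properties using (nonempty?)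
open import Data.Product using (Σ; _×_; ∃-syntax)
open import Relation.Nullary using (does)
open import Relation.Binary.PropositionalEquality using (_≡_)

-- A sequential (adaptive) group-testing algorithm on the items Fin n,
-- presented as a finite binary decision tree.
--   leaf D       : stop and declare D to be the set of defectives
--   test S neg pos : test the subset S; continue with neg if the outcome
--                    is negative, with pos if it is positive
data Algorithm (n : ℕ) : Set where
  leaf : Subset n → Algorithm n
  test : Subset n → Algorithm n → Algorithm n → Algorithm n

outcome : ∀ {n} → Subset n → Subset n → Bool
outcome S D = does (nonempty? (S ∩ D))

output : ∀ {n} → Algorithm n → Subset n → Subset n
output (leaf E) D = E
output (test S neg pos) D = if outcome S D then output pos D else output neg D

numTests : ∀ {n} → Algorithm n → Subset n → ℕ
numTests (leaf E) D = 0
numTests (test S neg pos) D = suc (if outcome S D then numTests pos D else numTests neg D)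

data TestsOfSize {n : ℕ} (k : ℕ) : Algorithm n → Set where
  leaf : ∀ E → TestsOfSize k (leaf E)
  test : ∀ {S neg pos} → ∣ S ∣ ≡ k → TestsOfSize k neg → TestsOfSize k pos →
         TestsOfSize k (test S neg pos)

Solves : ∀ {n} → ℕ → Algorithm n → Set
Solves {n} d A = (D : Subset n) → ∣ D ∣ ≡ d → output A D ≡ D

WorstCaseAtMost : ∀ {n} → ℕ → Algorithm n → ℕ → Set
WorstCaseAtMost {n} d A m = (D : Subset n) → ∣ D ∣ ≡ d → numTests A D ≤ m

WorstCaseAtLeast : ∀ {n} → ℕ → Algorithm n → ℕ → Set
WorstCaseAtLeast {n} d A m = Σ (Subset n) λ D → (∣ D ∣ ≡ d) × (m ≤ numTests A D)

M[_]≡ : ℕ → ℕ → ℕ → ℕ → Set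
M[ k ]≡ d n m =
  (Σ (Algorithm n) λ A → (TestsOfSize k A × Solves d A × WorstCaseAtMost d A m)) ×
  ((A : Algorithm n) → TestsOfSize k A → Solves d A → WorstCaseAtLeast d A m)

-- Upper bound: test the items one at a time except the last, whose status
-- is then determined by the count d.
--
-- Lower bound: an adversary maintains partial knowledge of the
-- defective set (the answers given so far) with the invariant that some
-- but not all of the still-unknown items must be defective, so that two
-- distinct defective sets of size d remain consistent and the algorithm
-- cannot stop yet. When an unknown item is tested, the adversary answers
-- "positive" if at least two unknown defectives remain, else "negative"
-- if at least two unknown non-defectives remain; either way the invariant
-- survives at the cost of one unknown. Neither is possible only when two
-- unknowns are left, and then the current test is the (n ∸ 1)-st.

module Submission where

open import Data.Bool using (Bool; true; false; if_then_else_)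
open import Data.Empty using (⊥-elim)
open import Data.Fin using (Fin; zero; suc)
open import Data.Fin.Subset using (Subset; ∣_∣; ⁅_⁆; ⊥; _∈_; _∉_)
open import Data.Fin.Subset.Properties
  using (nonempty?; x∈p∩q⁺; x∈p∩q⁻; x∈⁅x⁆; x∈⁅y⁆⇒x≡y; ∣⁅x⁆∣≡1)
open import Data.Maybe using (Maybe; just; nothing)
open import Data.Maybe.Relation.Unary.All using (just; nothing) renaming (All to AllMaybe)
open import Data.Nat using (ℕ; zero; suc; _+_; _∸_; _≤_; _<_; _<?_; z≤n; s≤s; s≤s⁻¹)
open import Data.Nat.Properties
open import Data.Product using (_×_; _,_; ∃-syntax)
open import Data.Sum using (_⊎_; inj₁; inj₂)
open import Data.Vec using (Vec; []; _∷_; lookup; replicate; tail; _[_]≔_)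
open import Data.Vec.Properties using (lookup⇒[]=; []=⇒lookup)
open import Data.Vec.Relation.Binary.Pointwise.Inductive using (Pointwise; []; _∷_)
open import Relation.Nullary using (yes; no)
open import Relation.Nullary.Decidable using (dec-true; dec-false)
open import Relation.Binary.PropositionalEquality

open import Defs

private variable
  n d r : ℕ
  b : Bool
  x : Fin n
  D : Subset n

∣p∣≡0⇒p≡⊥ : (S : Subset n) → ∣ S ∣ ≡ 0 → S ≡ ⊥
∣p∣≡0⇒p≡⊥ []          _  = refl
∣p∣≡0⇒p≡⊥ (false ∷ S) eq = cong (false ∷_) (∣p∣≡0⇒p≡⊥ S eq)

∣p∣≡1⇒p≡⁅x⁆ : (S : Subset n) → ∣ S ∣ ≡ 1 → ∃[ x ] S ≡ ⁅ x ⁆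
∣p∣≡1⇒p≡⁅x⁆ (true ∷ S) eq = zero , cong (true ∷_) (∣p∣≡0⇒p≡⊥ S (suc-injective eq))
∣p∣≡1⇒p≡⁅x⁆ (false ∷ S) eq with ∣p∣≡1⇒p≡⁅x⁆ S eq
... | x , refl = suc x , refl

outcome-⁅⁆ : (x : Fin n) (D : Subset n) → outcome ⁅ x ⁆ D ≡ lookup D x
outcome-⁅⁆ x D with lookup D x in eq
... | true  = dec-true (nonempty? _) (x , x∈p∩q⁺ (x∈⁅x⁆ x , lookup⇒[]= x D eq))
... | false = dec-false (nonempty? _) λ (y , y∈⁅x⁆∩D) →
  let y∈⁅x⁆ , y∈D = x∈p∩q⁻ _ _ y∈⁅x⁆∩D in x∉D (subst (_∈ D) (x∈⁅y⁆⇒x≡y x y∈⁅x⁆) y∈D)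
  where
  x∉D : x ∉ D
  x∉D x∈D with () ← trans (sym eq) ([]=⇒lookup x∈D)

-- A test node is written test ⁅ x ⁆ (f false) (f true), with f the branch
-- taken on each outcome; for f b = if b then pos else neg this is
-- definitionally test ⁅ x ⁆ neg pos.
output-test⁅⁆ : (f : Bool → Algorithm n) (x : Fin n) (D : Subset n) →
                output (test ⁅ x ⁆ (f false) (f true)) D ≡ output (f (lookup D x)) D
output-test⁅⁆ f x D rewrite outcome-⁅⁆ x D with lookup D x
... | true  = refl
... | false = refl

numTests-test⁅⁆ : (f : Bool → Algorithm n) (x : Fin n) (D : Subset n) →
                  numTests (test ⁅ x ⁆ (f false) (f true)) D ≡ suc (numTests (f (lookup D x)) D)
numTests-test⁅⁆ f x D rewrite outcome-⁅⁆ x D with lookup D x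
... | true  = refl
... | false = refl

-- Partial knowledge of the defective set

-- nothing: not tested yet; just b: known to be defective iff b.
Knowledge : ℕ → Set
Knowledge n = Vec (Maybe Bool) n

ignorance : ∀ n → Knowledge n
ignorance n = replicate n nothing

unknowns : Knowledge n → ℕ
unknowns []            = 0
unknowns (nothing ∷ p) = suc (unknowns p)
unknowns (just _ ∷ p)  = unknowns p

knownDefectives : Knowledge n → ℕ
knownDefectives []               = 0
knownDefectives (nothing ∷ p)    = knownDefectives p
knownDefectives (just true ∷ p)  = suc (knownDefectives p)
knownDefectives (just false ∷ p) = knownDefectives p

Consistent : Subset n → Knowledge n → Set
Consistent = Pointwise (λ b → AllMaybe (b ≡_))

private variable
  p q : Knowledge n

unknowns-ignorance : ∀ n → unknowns (ignorance n) ≡ n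
unknowns-ignorance zero    = refl
unknowns-ignorance (suc n) = cong suc (unknowns-ignorance n)

knownDefectives-ignorance : ∀ n → knownDefectives (ignorance n) ≡ 0
knownDefectives-ignorance zero    = refl
knownDefectives-ignorance (suc n) = knownDefectives-ignorance n

consistent-ignorance : (D : Subset n) → Consistent D (ignorance n)
consistent-ignorance []      = []
consistent-ignorance (_ ∷ D) = nothing ∷ consistent-ignorance D

consistent-lookup : Consistent D p → (x : Fin n) → lookup p x ≡ just b → lookup D x ≡ b
consistent-lookup (just e ∷ _) zero    refl = e
consistent-lookup (nothing ∷ _) zero   ()
consistent-lookup (_ ∷ c)      (suc x) eq   = consistent-lookup c x eq

consistent-[]≔ : Consistent D p → (x : Fin n) → Consistent D (p [ x ]≔ just (lookup D x))
consistent-[]≔ (_ ∷ c) zero    = just refl ∷ c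
consistent-[]≔ (a ∷ c) (suc x) = a ∷ consistent-[]≔ c x

consistent-[]≔⁻ : (p : Knowledge n) (x : Fin n) → lookup p x ≡ nothing →
                  Consistent D (p [ x ]≔ just b) → Consistent D p × lookup D x ≡ b
consistent-[]≔⁻ (nothing ∷ _) zero    _  (just e ∷ c) = nothing ∷ c , e
consistent-[]≔⁻ (_ ∷ p)       (suc x) eq (a ∷ c)     =
  let c′ , e = consistent-[]≔⁻ p x eq c in a ∷ c′ , e

unknowns-[]≔ : (p : Knowledge n) (x : Fin n) (b : Bool) → lookup p x ≡ nothing →
               unknowns p ≡ suc (unknowns (p [ x ]≔ just b))
unknowns-[]≔ (nothing ∷ _) zero    _ _  = refl
unknowns-[]≔ (nothing ∷ p) (suc x) b eq = cong suc (unknowns-[]≔ p x b eq)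
unknowns-[]≔ (just _ ∷ p)  (suc x) b eq = unknowns-[]≔ p x b eq

knownDefectives-[]≔true : (p : Knowledge n) (x : Fin n) → lookup p x ≡ nothing →
                          knownDefectives (p [ x ]≔ just true) ≡ suc (knownDefectives p)
knownDefectives-[]≔true (nothing ∷ _)    zero    _  = refl
knownDefectives-[]≔true (nothing ∷ p)    (suc x) eq = knownDefectives-[]≔true p x eq
knownDefectives-[]≔true (just true ∷ p)  (suc x) eq = cong suc (knownDefectives-[]≔true p x eq)
knownDefectives-[]≔true (just false ∷ p) (suc x) eq = knownDefectives-[]≔true p x eq

knownDefectives-[]≔false : (p : Knowledge n) (x : Fin n) → lookup p x ≡ nothing →
                           knownDefectives (p [ x ]≔ just false) ≡ knownDefectives p
knownDefectives-[]≔false (nothing ∷ _)    zero    _  = refl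
knownDefectives-[]≔false (nothing ∷ p)    (suc x) eq = knownDefectives-[]≔false p x eq
knownDefectives-[]≔false (just true ∷ p)  (suc x) eq = cong suc (knownDefectives-[]≔false p x eq)
knownDefectives-[]≔false (just false ∷ p) (suc x) eq = knownDefectives-[]≔false p x eq

firstUnknown : (p : Knowledge n) → unknowns p ≡ 0 ⊎ ∃[ x ] lookup p x ≡ nothing
firstUnknown []            = inj₁ refl
firstUnknown (nothing ∷ p) = inj₂ (zero , refl)
firstUnknown (just _ ∷ p) with firstUnknown p
... | inj₁ none     = inj₁ none
... | inj₂ (x , eq) = inj₂ (suc x , eq)

complete : Knowledge n → ℕ → Subset n
complete []            _       = []
complete (just b ∷ p)  r       = b ∷ complete p r
complete (nothing ∷ p) zero    = false ∷ complete p zero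
complete (nothing ∷ p) (suc r) = true ∷ complete p r

complete′ : Knowledge n → ℕ → Subset n
complete′ []            _ = []
complete′ (just b ∷ p)  r = b ∷ complete′ p r
complete′ (nothing ∷ p) r = false ∷ complete p r

consistent-complete : (p : Knowledge n) (r : ℕ) → Consistent (complete p r) p
consistent-complete []            _       = []
consistent-complete (just _ ∷ p)  r       = just refl ∷ consistent-complete p r
consistent-complete (nothing ∷ p) zero    = nothing ∷ consistent-complete p zero
consistent-complete (nothing ∷ p) (suc r) = nothing ∷ consistent-complete p r

consistent-complete′ : (p : Knowledge n) (r : ℕ) → Consistent (complete′ p r) p
consistent-complete′ []            _ = []
consistent-complete′ (just _ ∷ p)  r = just refl ∷ consistent-complete′ p r
consistent-complete′ (nothing ∷ p) r = nothing ∷ consistent-complete p r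

∣complete∣ : (p : Knowledge n) → r ≤ unknowns p → ∣ complete p r ∣ ≡ knownDefectives p + r
∣complete∣ {r = zero}  []               _         = refl
∣complete∣             (just true ∷ p)  r≤u       = cong suc (∣complete∣ p r≤u)
∣complete∣             (just false ∷ p) r≤u       = ∣complete∣ p r≤u
∣complete∣ {r = zero}  (nothing ∷ p)    _         = ∣complete∣ p z≤n
∣complete∣ {r = suc r} (nothing ∷ p)    (s≤s r≤u) =
  trans (cong suc (∣complete∣ p r≤u)) (sym (+-suc (knownDefectives p) r))

∣complete′∣ : (p : Knowledge n) → r < unknowns p → ∣ complete′ p r ∣ ≡ knownDefectives p + r
∣complete′∣ (just true ∷ p)  r<u       = cong suc (∣complete′∣ p r<u)
∣complete′∣ (just false ∷ p) r<u       = ∣complete′∣ p r<u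
∣complete′∣ (nothing ∷ p)    (s≤s r≤u) = ∣complete∣ p r≤u

complete≢complete′ : (p : Knowledge n) → 0 < r → r < unknowns p → complete p r ≢ complete′ p r
complete≢complete′ {r = suc _} (just _ ∷ p) 0<r r<u eq =
  complete≢complete′ p 0<r r<u (cong tail eq)

allKnown⇒complete≡ : unknowns p ≡ 0 → Consistent D p → ∀ r → complete p r ≡ D
allKnown⇒complete≡ _    []             _ = refl
allKnown⇒complete≡ none (just refl ∷ c) r = cong (_ ∷_) (allKnown⇒complete≡ none c r)

allKnown⇒∣D∣≡ : unknowns p ≡ 0 → Consistent D p → ∣ D ∣ ≡ knownDefectives p
allKnown⇒∣D∣≡ {p = p} {D = D} none c = begin
  ∣ D ∣                      ≡⟨ cong ∣_∣ (allKnown⇒complete≡ none c 0) ⟨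
  ∣ complete p 0 ∣           ≡⟨ ∣complete∣ p z≤n ⟩
  knownDefectives p + 0      ≡⟨ +-identityʳ _ ⟩
  knownDefectives p          ∎
  where open ≡-Reasoning

complete-determined : Consistent D p → unknowns p ≤ 1 →
                      complete p (∣ D ∣ ∸ knownDefectives p) ≡ D
complete-determined []                                  _ = refl
complete-determined {D = true ∷ _} (just refl ∷ c) u≤1 = cong (true ∷_) (complete-determined c u≤1)
complete-determined {D = false ∷ _} (just refl ∷ c) u≤1 = cong (false ∷_) (complete-determined c u≤1)
complete-determined {D = true ∷ D} {p = nothing ∷ p} (nothing ∷ c) (s≤s u≤0)
  rewrite allKnown⇒∣D∣≡ (n≤0⇒n≡0 u≤0) c | m+n∸n≡m 1 (knownDefectives p) =
  cong (true ∷_) (allKnown⇒complete≡ (n≤0⇒n≡0 u≤0) c 0)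
complete-determined {D = false ∷ D} {p = nothing ∷ p} (nothing ∷ c) (s≤s u≤0)
  rewrite allKnown⇒∣D∣≡ (n≤0⇒n≡0 u≤0) c | n∸n≡0 (knownDefectives p) =
  cong (false ∷_) (allKnown⇒complete≡ (n≤0⇒n≡0 u≤0) c 0)

-- Upper bound: testing the unknown items one at a time

-- d is the number of defectives and k the number of tests still allowed.
sweep : ℕ → ℕ → Knowledge n → Algorithm n
sweep d zero    p = leaf (complete p (d ∸ knownDefectives p))
sweep d (suc k) p with firstUnknown p
... | inj₁ _       = leaf (complete p (d ∸ knownDefectives p))
... | inj₂ (x , _) = test ⁅ x ⁆ (sweep d k (p [ x ]≔ just false)) (sweep d k (p [ x ]≔ just true))

sweep-singletons : ∀ d k (p : Knowledge n) → TestsOfSize 1 (sweep d k p)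
sweep-singletons d zero    p = leaf _
sweep-singletons d (suc k) p with firstUnknown p
... | inj₁ _       = leaf _
... | inj₂ (x , _) = test (∣⁅x⁆∣≡1 x) (sweep-singletons d k _) (sweep-singletons d k _)

sweep-numTests : ∀ d k (p : Knowledge n) (D : Subset n) → numTests (sweep d k p) D ≤ k
sweep-numTests d zero    p D = z≤n
sweep-numTests d (suc k) p D with firstUnknown p
... | inj₁ _       = z≤n
... | inj₂ (x , _) rewrite numTests-test⁅⁆ (λ b → sweep d k (p [ x ]≔ just b)) x D =
  s≤s (sweep-numTests d k _ D)

sweep-correct : ∀ k → Consistent D p → unknowns p ≤ suc k → output (sweep ∣ D ∣ k p) D ≡ D
sweep-correct zero c u≤1 = complete-determined c u≤1
sweep-correct {D = D} {p = p} (suc k) c u≤2+k with firstUnknown p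
... | inj₁ none          = complete-determined c (subst (_≤ 1) (sym none) z≤n)
... | inj₂ (x , unknown) =
  trans (output-test⁅⁆ (λ b → sweep ∣ D ∣ k (p [ x ]≔ just b)) x D)
        (sweep-correct k (consistent-[]≔ c x)
          (s≤s⁻¹ (subst (_≤ suc (suc k)) (unknowns-[]≔ p x (lookup D x) unknown) u≤2+k)))

-- Lower bound: the adversary

Candidate : Knowledge n → ℕ → Subset n → Set
Candidate p d D = Consistent D p × ∣ D ∣ ≡ d

Ambiguous : Knowledge n → ℕ → Set
Ambiguous p d = knownDefectives p < d × d < knownDefectives p + unknowns p

SolvesGiven : Knowledge n → ℕ → Algorithm n → Set
SolvesGiven p d A = ∀ D → Candidate p d D → output A D ≡ D

HardCandidate : Knowledge n → ℕ → Algorithm n → Set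
HardCandidate p d A = ∃[ D ] Candidate p d D × unknowns p ≤ suc (numTests A D)

Adversary : ℕ → Algorithm n → Set
Adversary {n} d A = ∀ {p : Knowledge n} → SolvesGiven p d A → Ambiguous p d → HardCandidate p d A

ambiguous-ignorance : 0 < d → d < n → Ambiguous (ignorance n) d
ambiguous-ignorance {n = n} 0<d d<n
  rewrite knownDefectives-ignorance n | unknowns-ignorance n = 0<d , d<n

ambiguous⇒two-candidates : Ambiguous p d →
  ∃[ D ] ∃[ D′ ] D ≢ D′ × Candidate p d D × Candidate p d D′
ambiguous⇒two-candidates {p = p} {d = d} (t<d , d<t+u) =
  complete p hidden , complete′ p hidden , complete≢complete′ p 0<h h<u ,
  (consistent-complete p hidden , trans (∣complete∣ p (<⇒≤ h<u)) t+h≡d) ,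
  (consistent-complete′ p hidden , trans (∣complete′∣ p h<u) t+h≡d)
  where
  hidden : ℕ
  hidden = d ∸ knownDefectives p
  t+h≡d : knownDefectives p + hidden ≡ d
  t+h≡d = m+[n∸m]≡n (<⇒≤ t<d)
  0<h : 0 < hidden
  0<h = m<n⇒0<n∸m t<d
  h<u : hidden < unknowns p
  h<u = +-cancelˡ-< (knownDefectives p) hidden (unknowns p) (subst (_< _) (sym t+h≡d) d<t+u)

ambiguity-split : ∀ {t u} → t < d → d < t + suc u →
                  (suc t < d × d < suc t + u) ⊎ (t < d × d < t + u) ⊎ u ≤ 1
ambiguity-split {d = d} {t} {u} t<d d<t+1+u with suc t <? d | d <? t + u
... | yes 1+t<d | _         = inj₁ (1+t<d , subst (d <_) (+-suc t u) d<t+1+u)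
... | no _      | yes d<t+u = inj₂ (inj₁ (t<d , d<t+u))
... | no 1+t≮d  | no d≮t+u  = inj₂ (inj₂ (+-cancelˡ-≤ t u 1 (begin
  t + u  ≤⟨ ≮⇒≥ d≮t+u ⟩
  d      ≤⟨ ≮⇒≥ 1+t≮d ⟩
  suc t  ≡⟨ +-comm 1 t ⟩
  t + 1  ∎)))
  where open ≤-Reasoning

ambiguous-step : (p : Knowledge n) (x : Fin n) → lookup p x ≡ nothing → Ambiguous p d →
                 Ambiguous (p [ x ]≔ just true) d ⊎ Ambiguous (p [ x ]≔ just false) d ⊎
                 unknowns p ≤ 2
ambiguous-step {d = d} p x unknown (t<d , d<t+u)
  with ambiguity-split t<d
         (subst (λ u → d < knownDefectives p + u) (unknowns-[]≔ p x false unknown) d<t+u)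
... | inj₁ positive = inj₁ (subst₂ (λ t u → t < d × d < t + u)
  (sym (knownDefectives-[]≔true p x unknown))
  (suc-injective (trans (sym (unknowns-[]≔ p x false unknown)) (unknowns-[]≔ p x true unknown)))
  positive)
... | inj₂ (inj₁ negative) = inj₂ (inj₁ (subst (λ t → t < d × d < t + unknowns (p [ x ]≔ just false))
  (sym (knownDefectives-[]≔false p x unknown))
  negative))
... | inj₂ (inj₂ u₀≤1) = inj₂ (inj₂ (subst (_≤ 2) (sym (unknowns-[]≔ p x false unknown)) (s≤s u₀≤1)))

Refines : Knowledge n → Knowledge n → Fin n → Bool → Set
Refines q p x b = ∀ {D} → Consistent D q → Consistent D p × lookup D x ≡ b

solvesGiven-branch : (f : Bool → Algorithm n) (x : Fin n) → Refines q p x b →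
                     SolvesGiven p d (test ⁅ x ⁆ (f false) (f true)) → SolvesGiven q d (f b)
solvesGiven-branch f x refines solves D (c , |D|≡d) with refines c
... | c′ , refl = trans (sym (output-test⁅⁆ f x D)) (solves D (c′ , |D|≡d))

hardCandidate-branch : (f : Bool → Algorithm n) (x : Fin n) → Refines q p x b →
                       unknowns p ≤ suc (unknowns q) →
                       HardCandidate q d (f b) → HardCandidate p d (test ⁅ x ⁆ (f false) (f true))
hardCandidate-branch {q = q} {p = p} f x refines u≤1+u′ (D , (c , |D|≡d) , bound) with refines c
... | c′ , refl = D , (c′ , |D|≡d) , (begin
  unknowns p                                           ≤⟨ u≤1+u′ ⟩
  suc (unknowns q)                                     ≤⟨ s≤s bound ⟩
  suc (suc (numTests (f (lookup D x)) D))              ≡⟨ cong suc (numTests-test⁅⁆ f x D) ⟨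
  suc (numTests (test ⁅ x ⁆ (f false) (f true)) D)     ∎)
  where open ≤-Reasoning

hardCandidate-forced : ∀ {S neg pos} → Ambiguous p d → unknowns p ≤ 2 →
                       HardCandidate p d (test S neg pos)
hardCandidate-forced ambiguous u≤2 with ambiguous⇒two-candidates ambiguous
... | D , _ , _ , cand , _ = D , cand , ≤-trans u≤2 (s≤s (s≤s z≤n))

adversary-leaf : (E : Subset n) → Adversary d (leaf E)
adversary-leaf E solves ambiguous with ambiguous⇒two-candidates ambiguous
... | D , D′ , D≢D′ , cand , cand′ = ⊥-elim (D≢D′ (trans (sym (solves D cand)) (solves D′ cand′)))

adversary-branch : (f : Bool → Algorithm n) (x : Fin n) → (∀ b → Adversary d (f b)) →
                   SolvesGiven p d (test ⁅ x ⁆ (f false) (f true)) →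
                   Refines q p x b → unknowns p ≤ suc (unknowns q) → Ambiguous q d →
                   HardCandidate p d (test ⁅ x ⁆ (f false) (f true))
adversary-branch {b = b} f x adversaries solves refines u≤1+u′ ambiguous′ =
  hardCandidate-branch f x refines u≤1+u′
    (adversaries b (solvesGiven-branch f x refines solves) ambiguous′)

adversary-unknown : (f : Bool → Algorithm n) (x : Fin n) → (∀ b → Adversary d (f b)) →
                    SolvesGiven p d (test ⁅ x ⁆ (f false) (f true)) → lookup p x ≡ nothing →
                    Ambiguous (p [ x ]≔ just b) d →
                    HardCandidate p d (test ⁅ x ⁆ (f false) (f true))
adversary-unknown {p = p} {b = b} f x adversaries solves unknown =
  adversary-branch f x adversaries solves
    (consistent-[]≔⁻ p x unknown) (≤-reflexive (unknowns-[]≔ p x b unknown))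

adversary-test⁅⁆ : (x : Fin n) (f : Bool → Algorithm n) → (∀ b → Adversary d (f b)) →
                   Adversary d (test ⁅ x ⁆ (f false) (f true))
adversary-test⁅⁆ x f adversaries {p} solves ambiguous with lookup p x in known
... | just b =
  adversary-branch f x adversaries solves
    (λ c → c , consistent-lookup c x known) (n≤1+n _) ambiguous
... | nothing with ambiguous-step p x known ambiguous
...   | inj₁ ambiguous′        = adversary-unknown f x adversaries solves known ambiguous′
...   | inj₂ (inj₁ ambiguous′) = adversary-unknown f x adversaries solves known ambiguous′
...   | inj₂ (inj₂ u≤2)        = hardCandidate-forced ambiguous u≤2

adversary : {A : Algorithm n} → TestsOfSize 1 A → Adversary d A
adversary (leaf E) = adversary-leaf E
adversary (test {S} {neg} {pos} |S|≡1 sizes-neg sizes-pos) with ∣p∣≡1⇒p≡⁅x⁆ S |S|≡1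
... | x , refl = adversary-test⁅⁆ x (λ b → if b then pos else neg) λ where
  true  → adversary sizes-pos
  false → adversary sizes-neg

singletons-upperBound : ∀ n d →
  ∃[ A ] TestsOfSize 1 A × Solves d A × WorstCaseAtMost d A (n ∸ 1)
singletons-upperBound n d =
  sweep d (n ∸ 1) (ignorance n) , sweep-singletons d (n ∸ 1) (ignorance n) , solves ,
  λ D _ → sweep-numTests d (n ∸ 1) (ignorance n) D
  where
  solves : Solves d (sweep d (n ∸ 1) (ignorance n))
  solves D |D|≡d = subst (λ d → output (sweep d (n ∸ 1) (ignorance n)) D ≡ D) |D|≡d
    (sweep-correct (n ∸ 1) (consistent-ignorance D)
      (subst (_≤ suc (n ∸ 1)) (sym (unknowns-ignorance n)) (m≤n+m∸n n 1)))

singletons-lowerBound : 0 < d → d < n → (A : Algorithm n) → TestsOfSize 1 A → Solves d A →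
                        WorstCaseAtLeast d A (n ∸ 1)
singletons-lowerBound {n = n} 0<d d<n A sizes solves
  with adversary sizes {p = ignorance n} (λ D (_ , |D|≡d) → solves D |D|≡d)
                 (ambiguous-ignorance 0<d d<n)
... | D , (_ , |D|≡d) , bound =
  D , |D|≡d , m≤n+o⇒m∸n≤o n 1 (subst (_≤ suc (numTests A D)) (unknowns-ignorance n) bound)

proposition5 : (n d : ℕ) → 2 ≤ n → 0 < d → d < n → M[ 1 ]≡ d n (n ∸ 1)
proposition5 n d _ 0<d d<n = singletons-upperBound n d , singletons-lowerBound 0<d d<n
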